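{- There is no strategy-proof algorithm (mechanism) that finds a stable matching in the single-peaked preference model.
   Context: A matching market has $n$ men and $n$ women. The men's preferences are single-peaked if the women are placed at points on a line, $p(w_1)<\dots<p(w_n)$, and each man $m$ has an ideal point $q(m)$ and a preference relation $\succ_m$ such that whenever $p(w_i)\le q(m)$ we have $w_i\succ_m w_j$ for all $j<i$, and whenever $p(w_i)\ge q(m)$ we have $w_i\succ_m w_j$ for all $j>i$; women's preferences are single-peaked analogously, and the market is single-peaked if both sides are. A matching $\mu$ is stable if there is no pair $(m,w)\notin\mu$ with $w\succ_m\mu(m)$ and $m\succ_w\mu(w)$. A mechanism takes the reported preference ideals of the participants (locations $p$ are fixed and cannot be misreported) and outputs a matching stable with respect to the reported preferences. It is strategy-proof if no participant can ever obtain a partner he or she strictly prefers (according to the true preferences) by misreporting while all others report truthfully. -}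

module Defs where

open import Data.Nat using (ℕ)
open import Data.Fin using (Fin; _<_; _≟_)
open import Data.Fin.Permutation using (Permutation; _⟨$⟩ʳ_; _⟨$⟩ˡ_)
open import Data.Rational using (ℚ) renaming (_≤_ to _≤ℚ_; _<_ to _<ℚ_)
open import Data.Product using (Σ; _×_; proj₁; proj₂; _,_)
open import Relation.Nullary using (¬_; yes; no)

-- A strict preference (linear order) over n agents of the other side,
-- represented as a ranking: π ⟨$⟩ʳ x is the rank of x (rank 0 = best).
Pref : ℕ → Set
Pref n = Permutation n n

_≻⟨_⟩_ : ∀ {n} → Fin n → Pref n → Fin n → Set
x ≻⟨ π ⟩ y = (π ⟨$⟩ʳ x) < (π ⟨$⟩ʳ y)

StrictlyIncreasing : ∀ {n} → (Fin n → ℚ) → Set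
StrictlyIncreasing {n} p = ∀ (i j : Fin n) → i < j → p i <ℚ p j

SinglePeaked : ∀ {n} → (Fin n → ℚ) → Pref n → ℚ → Set
SinglePeaked {n} p π q =
  ∀ (i j : Fin n) → (p i ≤ℚ q → j < i → i ≻⟨ π ⟩ j) × (q ≤ℚ p i → i < j → i ≻⟨ π ⟩ j)

Report : ∀ {n} → (Fin n → ℚ) → Set
Report {n} p = Σ (Pref n) λ π → Σ ℚ λ q → SinglePeaked p π q

prefOf : ∀ {n} {p : Fin n → ℚ} → Report p → Pref n
prefOf r = proj₁ r

-- Profile: men's reports (over women, located by pW) and women's reports
-- (over men, located by pM).
Profile : ∀ {n} → (pW pM : Fin n → ℚ) → Set
Profile {n} pW pM = (Fin n → Report pW) × (Fin n → Report pM)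

-- A (perfect) matching: man m is matched to woman μ ⟨$⟩ʳ m.
Matching : ℕ → Set
Matching n = Permutation n n

update : ∀ {n} {A : Set} → (Fin n → A) → Fin n → A → Fin n → A
update f a r b with b ≟ a
... | yes _ = r
... | no  _ = f b

Stable : ∀ {n} {pW pM : Fin n → ℚ} → Profile pW pM → Matching n → Set
Stable {n} (men , women) μ =
  ∀ (m w : Fin n) →
    ¬ ((w ≻⟨ prefOf (men m) ⟩ (μ ⟨$⟩ʳ m)) × (m ≻⟨ prefOf (women w) ⟩ (μ ⟨$⟩ˡ w)))

Mechanism : Set
Mechanism = ∀ {n} (pW pM : Fin n → ℚ) → StrictlyIncreasing pW → StrictlyIncreasing pM →
            Profile pW pM → Matching n

AlwaysStable : Mechanism → Set
AlwaysStable M = ∀ {n} (pW pM : Fin n → ℚ) (iW : StrictlyIncreasing pW) (iM : StrictlyIncreasing pM)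
                   (prof : Profile pW pM) → Stable prof (M pW pM iW iM prof)

StrategyProof : Mechanism → Set
StrategyProof M = ∀ {n} (pW pM : Fin n → ℚ) (iW : StrictlyIncreasing pW) (iM : StrictlyIncreasing pM)
                    (men : Fin n → Report pW) (women : Fin n → Report pM) →
  (∀ (m : Fin n) (r : Report pW) →
     ¬ ((M pW pM iW iM (update men m r , women) ⟨$⟩ʳ m)
          ≻⟨ prefOf (men m) ⟩ (M pW pM iW iM (men , women) ⟨$⟩ʳ m)))
  × (∀ (w : Fin n) (r : Report pM) →
     ¬ ((M pW pM iW iM (men , update women w r) ⟨$⟩ˡ w)
          ≻⟨ prefOf (women w) ⟩ (M pW pM iW iM (men , women) ⟨$⟩ˡ w)))

module Submission where

-- Put three men and three women at the points 0, 1, 2 of a line.  Men m₀, m₂ rank the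
-- women 0 ≻ 1 ≻ 2 and m₁ ranks them 1 ≻ 0 ≻ 2; women w₁, w₂ rank the men 0 ≻ 1 ≻ 2 and
-- w₀ ranks them 1 ≻ 0 ≻ 2.  In every stable matching w₀ is matched to m₀ or m₁ (else
-- (m₀, w₀) blocks).  If she gets m₀, reporting 1 ≻ 2 ≻ 0 instead leaves her m₁ as the
-- only stable partner; if m₁ gets w₀, reporting 1 ≻ 2 ≻ 0 instead leaves him w₁ as the
-- only stable partner.  Either way some agent gains by lying.

open import Data.Empty using (⊥; ⊥-elim)
open import Data.Fin using (Fin; zero; suc; toℕ; _<?_)
open import Data.Fin.Patterns using (0F; 1F; 2F)
open import Data.Fin.Permutation using (Permutation; _⟨$⟩ʳ_; _⟨$⟩ˡ_; id; transpose; _∘ₚ_)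
open import Data.Fin.Properties using (all?)
open import Data.Integer using (+_)
open import Data.Nat as ℕ using (ℕ; z<s)
open import Data.Product using (Σ; _×_; _,_; proj₁; proj₂)
open import Data.Rational using (ℚ; _/_)
import Data.Rational.Properties as ℚ
open import Data.Sum using (_⊎_; inj₁; inj₂; [_,_]′)
open import Function.Bundles using (Inverse)
open import Relation.Binary.PropositionalEquality using (_≡_; _≢_; refl; sym; trans)
open import Relation.Nullary using (¬_; Dec)
open import Relation.Nullary.Decidable using (True; toWitness; from-yes; _×-dec_; _→-dec_)
open import Relation.Nullary.Negation using (contradiction)

open import Defs

module _ {m n} (π : Permutation m n) where

  ⟨$⟩ˡ⇒⟨$⟩ʳ : ∀ {i j} → π ⟨$⟩ˡ j ≡ i → π ⟨$⟩ʳ i ≡ j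
  ⟨$⟩ˡ⇒⟨$⟩ʳ e = Inverse.inverseˡ π (sym e)

  ⟨$⟩ʳ⇒⟨$⟩ˡ : ∀ {i j} → π ⟨$⟩ʳ i ≡ j → π ⟨$⟩ˡ j ≡ i
  ⟨$⟩ʳ⇒⟨$⟩ˡ e = Inverse.inverseʳ π (sym e)

  ⟨$⟩ʳ-injective : ∀ {i i′ j} → π ⟨$⟩ʳ i ≡ j → π ⟨$⟩ʳ i′ ≡ j → i ≡ i′
  ⟨$⟩ʳ-injective e e′ = trans (sym (⟨$⟩ʳ⇒⟨$⟩ˡ e)) (⟨$⟩ʳ⇒⟨$⟩ˡ e′)

  ⟨$⟩ˡ-injective : ∀ {i j j′} → π ⟨$⟩ˡ j ≡ i → π ⟨$⟩ˡ j′ ≡ i → j ≡ j′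
  ⟨$⟩ˡ-injective e e′ = trans (sym (⟨$⟩ˡ⇒⟨$⟩ʳ e)) (⟨$⟩ˡ⇒⟨$⟩ʳ e′)

  ⟨$⟩ʳ-≢ : ∀ {i i′ j} → π ⟨$⟩ˡ j ≡ i′ → i ≢ i′ → π ⟨$⟩ʳ i ≢ j
  ⟨$⟩ʳ-≢ e i≢i′ e′ = i≢i′ (trans (sym (⟨$⟩ʳ⇒⟨$⟩ˡ e′)) e)

by-ranks : ∀ {i j : ℕ} {i<j : True (i ℕ.<? j)} → i ℕ.< j
by-ranks {i<j = i<j} = toWitness i<j

top-≻ : ∀ {n} {π : Pref (ℕ.suc n)} {x y} → π ⟨$⟩ʳ x ≡ zero → y ≢ x → x ≻⟨ π ⟩ y
top-≻ {π = π} {x} {y} top y≢x with π ⟨$⟩ʳ y in e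
... | zero  = contradiction (⟨$⟩ʳ-injective π e top) y≢x
... | suc _ rewrite top = z<s

singlePeaked? : ∀ {n} (p : Fin n → ℚ) (π : Pref n) (q : ℚ) → Dec (SinglePeaked p π q)
singlePeaked? p π q = all? λ i → all? λ j →
  (p i ℚ.≤? q →-dec (j <? i →-dec π ⟨$⟩ʳ i <? π ⟨$⟩ʳ j)) ×-dec
  (q ℚ.≤? p i →-dec (i <? j →-dec π ⟨$⟩ʳ i <? π ⟨$⟩ʳ j))

strictlyIncreasing? : ∀ {n} (p : Fin n → ℚ) → Dec (StrictlyIncreasing p)
strictlyIncreasing? p = all? λ i → all? λ j → i <? j →-dec p i ℚ.<? p j

blocking-pair : ∀ {n} {pW pM : Fin n → ℚ} (prof : Profile pW pM) (μ : Matching n) →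
                Stable prof μ → ∀ m w {w′ m′} → μ ⟨$⟩ʳ m ≡ w′ → μ ⟨$⟩ˡ w ≡ m′ →
                w ≻⟨ prefOf (proj₁ prof m) ⟩ w′ → m ≻⟨ prefOf (proj₂ prof w) ⟩ m′ → ⊥
blocking-pair _ _ stable m w refl refl w≻ m≻ = stable m w (w≻ , m≻)

top-choice-blocks : ∀ {n} {pW pM : Fin (ℕ.suc n) → ℚ}
                    (prof : Profile pW pM) (μ : Matching (ℕ.suc n)) →
                    Stable prof μ → ∀ m w {m′} → prefOf (proj₁ prof m) ⟨$⟩ʳ w ≡ zero →
                    μ ⟨$⟩ˡ w ≡ m′ → m ≢ m′ → m ≻⟨ prefOf (proj₂ prof w) ⟩ m′ → ⊥
top-choice-blocks prof μ stable m w top e m≢m′ =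
  blocking-pair prof μ stable m w refl e
    (top-≻ {π = prefOf (proj₁ prof m)} top (⟨$⟩ʳ-≢ μ e m≢m′))

position : Fin 3 → ℚ
position i = + toℕ i / 1

position-increasing : StrictlyIncreasing position
position-increasing = from-yes (strictlyIncreasing? position)

-- Abstract, so that checking the lemmas below never normalises these proofs.
abstract
  single-peaked : ∀ {n} (p : Fin n → ℚ) π q → True (singlePeaked? p π q) → SinglePeaked p π q
  single-peaked p π q = toWitness

report : (π : Pref 3) (q : ℚ) {peaked : True (singlePeaked? position π q)} → Report position
report π q {peaked} = π , q , single-peaked position π q peaked

0≻1≻2 1≻0≻2 1≻2≻0 : Report position
0≻1≻2 = report id (position 0F)
1≻0≻2 = report (transpose 0F 1F) (position 1F)
1≻2≻0 = report (transpose 0F 1F ∘ₚ transpose 1F 2F) (position 1F)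

men women : Fin 3 → Report position
men 1F = 1≻0≻2
men _  = 0≻1≻2
women 0F = 1≻0≻2
women _  = 0≻1≻2

truthful w₀-lies m₁-lies : Profile position position
truthful = men , women
w₀-lies  = men , update women 0F 1≻2≻0
m₁-lies  = update men 1F 1≻2≻0 , women

truthful-pairs-w₀-m₀⊎m₁-w₀ : (μ : Matching 3) → Stable truthful μ →
                             μ ⟨$⟩ˡ 0F ≡ 0F ⊎ μ ⟨$⟩ʳ 1F ≡ 0F
truthful-pairs-w₀-m₀⊎m₁-w₀ μ stable with μ ⟨$⟩ˡ 0F in e
... | 0F = inj₁ refl
... | 1F = inj₂ (⟨$⟩ˡ⇒⟨$⟩ʳ μ e)
... | 2F = ⊥-elim (top-choice-blocks truthful μ stable 0F 0F refl e (λ ()) by-ranks)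

w₀-lie-gets-m₁ : (μ : Matching 3) → Stable w₀-lies μ → μ ⟨$⟩ˡ 0F ≡ 1F
w₀-lie-gets-m₁ μ stable with μ ⟨$⟩ˡ 0F in e
... | 1F = refl
... | 0F = ⊥-elim (top-choice-blocks w₀-lies μ stable 2F 0F refl e (λ ()) by-ranks)
... | 2F with μ ⟨$⟩ʳ 1F in e₁
...   | 0F = contradiction (⟨$⟩ʳ-injective μ (⟨$⟩ˡ⇒⟨$⟩ʳ μ e) e₁) λ ()
...   | 2F = ⊥-elim (blocking-pair w₀-lies μ stable 1F 0F e₁ e by-ranks by-ranks)
...   | 1F with μ ⟨$⟩ʳ 0F in e₀
...     | 0F = contradiction (⟨$⟩ʳ-injective μ (⟨$⟩ˡ⇒⟨$⟩ʳ μ e) e₀) λ ()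
...     | 1F = contradiction (⟨$⟩ʳ-injective μ e₀ e₁) λ ()
...     | 2F = ⊥-elim (blocking-pair w₀-lies μ stable 0F 1F e₀ (⟨$⟩ʳ⇒⟨$⟩ˡ μ e₁) by-ranks by-ranks)

m₁-lie-gets-w₁ : (μ : Matching 3) → Stable m₁-lies μ → μ ⟨$⟩ʳ 1F ≡ 1F
m₁-lie-gets-w₁ μ stable with μ ⟨$⟩ˡ 1F in e
... | 1F = ⟨$⟩ˡ⇒⟨$⟩ʳ μ e
... | 2F = ⊥-elim (top-choice-blocks m₁-lies μ stable 1F 1F refl e (λ ()) by-ranks)
... | 0F with μ ⟨$⟩ʳ 1F in e₁
...   | 1F = refl
...   | 0F with μ ⟨$⟩ˡ 2F in e₂
...     | 0F = contradiction (⟨$⟩ˡ-injective μ e e₂) λ ()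
...     | 1F = contradiction (trans (sym e₁) (⟨$⟩ˡ⇒⟨$⟩ʳ μ e₂)) λ ()
...     | 2F = ⊥-elim (blocking-pair m₁-lies μ stable 1F 2F e₁ e₂ by-ranks by-ranks)
m₁-lie-gets-w₁ μ stable | 0F | 2F with μ ⟨$⟩ˡ 0F in e₀
...     | 0F = contradiction (⟨$⟩ˡ-injective μ e e₀) λ ()
...     | 1F = contradiction (trans (sym e₁) (⟨$⟩ˡ⇒⟨$⟩ʳ μ e₀)) λ ()
...     | 2F = ⊥-elim (blocking-pair m₁-lies μ stable 0F 0F (⟨$⟩ˡ⇒⟨$⟩ʳ μ e) e₀ by-ranks by-ranks)

corollary9 : ¬ (Σ Mechanism λ M → AlwaysStable M × StrategyProof M)
corollary9 (M , always-stable , strategy-proof) =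
  let no-man-gains , no-woman-gains =
        strategy-proof position position position-increasing position-increasing men women
  in [ (λ w₀↦m₀ → no-woman-gains 0F 1≻2≻0
                    (improves (w₀-lie-gets-m₁ (outcome w₀-lies) (stable w₀-lies)) w₀↦m₀))
     , (λ m₁↦w₀ → no-man-gains 1F 1≻2≻0
                    (improves (m₁-lie-gets-w₁ (outcome m₁-lies) (stable m₁-lies)) m₁↦w₀))
     ]′ (truthful-pairs-w₀-m₀⊎m₁-w₀ (outcome truthful) (stable truthful))
  where
  outcome : Profile position position → Matching 3
  outcome = M position position position-increasing position-increasing

  stable : (prof : Profile position position) → Stable prof (outcome prof)
  stable = always-stable position position position-increasing position-increasing

  improves : ∀ {a b} → a ≡ 1F → b ≡ 0F → a ≻⟨ prefOf 1≻0≻2 ⟩ b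
  improves refl refl = by-ranks
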